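{- Let $L\ge 2$, let $(q_n)_{n\ge0}$ be integers with $q_0=1$ and $q_n\ge 2$ for $n\ge1$, for each $n\ge0$ let $\mu_n:\{1,\dots,q_{n+1}-1\}\to\{0,\dots,L-1\}$, let $a_0,\dots,a_{L-1}$ be $L$ distinct complex numbers, and let $A_\infty=(a(n))_{n\ge0}$ be the $(L,(q_n),(\mu_n))$-TM sequence over these letters. Then $A_\infty$ is ultimately periodic if and only if there exists an integer $A\ge0$ such that $$\mu_{A+y}(s)\equiv \mu_A(1)\,s\,q_0\prod_{j=A+1}^{A+y}q_j\pmod L$$ for all integers $y\ge0$ and all $s$ with $1\le s\le q_{A+y+1}-1$. Moreover, if $A_\infty$ is not ultimately periodic, then for all integers $N\ge0$ and $l\ge1$ the subsequence $(a(N+nl))_{n\ge0}$ is not ultimately periodic.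
   Context: Generalized Thue–Morse sequence: let $f$ be the monoid morphism on words over $\{a_0,\dots,a_{L-1}\}$ with $f(a_i)=a_{i+1}$, indices taken modulo $L$; $f^j$ is the $j$-fold composite and $f^0$ the identity. Set $A_0=a_0$ and recursively $A_{n+1}:=A_n\,f^{\mu_n(1)}(A_n)\,f^{\mu_n(2)}(A_n)\cdots f^{\mu_n(q_{n+1}-1)}(A_n)$ (concatenation), so $A_n$ has length $\prod_{j=0}^{n}q_j$ and is a prefix of $A_{n+1}$. The infinite word $A_\infty:=\lim_{n\to\infty}A_n$ is the $(L,(q_n),(\mu_n))$-TM sequence. Empty products equal $1$. -}

module Defs where

open import Data.Nat using (ℕ; zero; suc; _+_; _*_; _≤_; NonZero)
open import Data.Nat.DivMod using (_mod_)
open import Data.Fin using (Fin; toℕ)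
open import Data.List using (List; []; _∷_; map; concat; upTo)
open import Data.Product using (Σ; _×_; ∃-syntax)
open import Relation.Binary.PropositionalEquality using (_≡_)

-- Letters a_0..a_{L-1} are represented by their indices i : Fin L.

shift : (L : ℕ) .{{_ : NonZero L}} → ℕ → Fin L → Fin L
shift L j i = (toℕ i + j) mod L

fpow : (L : ℕ) .{{_ : NonZero L}} → ℕ → List (Fin L) → List (Fin L)
fpow L j w = map (shift L j) w

-- exponent of the k-th block of A_{n+1}, k = 0 .. q_{n+1}-1; block 0 is A_n itself
blockExp : {L : ℕ} → (μ : ℕ → ℕ → Fin L) → ℕ → ℕ → ℕ
blockExp μ n zero    = 0
blockExp μ n (suc k) = toℕ (μ n (suc k))

TMword : (L : ℕ) .{{_ : NonZero L}} → (q : ℕ → ℕ) → (μ : ℕ → ℕ → Fin L) → ℕ → List (Fin L)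
TMword L q μ zero    = (0 mod L) ∷ []
TMword L q μ (suc n) =
  concat (map (λ k → fpow L (blockExp μ n k) (TMword L q μ n)) (upTo (q (suc n))))

nth : {A : Set} → A → List A → ℕ → A
nth d []       _       = d
nth d (x ∷ xs) zero    = x
nth d (x ∷ xs) (suc n) = nth d xs n

-- A_∞(n): since |A_n| = ∏_{j≤n} q_j ≥ 2^n > n and A_n is a prefix of A_∞,
-- the n-th letter of A_∞ is the n-th letter of A_n (default never used under the hypotheses).
TMindex : (L : ℕ) .{{_ : NonZero L}} → (q : ℕ → ℕ) → (μ : ℕ → ℕ → Fin L) → ℕ → Fin L
TMindex L q μ n = nth (0 mod L) (TMword L q μ n) n

TMseq : {X : Set} (L : ℕ) .{{_ : NonZero L}} → (ℓ : Fin L → X) → (q : ℕ → ℕ) → (μ : ℕ → ℕ → Fin L) → ℕ → X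
TMseq L ℓ q μ n = ℓ (TMindex L q μ n)

prodRange : (ℕ → ℕ) → ℕ → ℕ → ℕ
prodRange q a zero    = 1
prodRange q a (suc y) = prodRange q a y * q (a + suc y)

UltPeriodic : {X : Set} → (ℕ → X) → Set
UltPeriodic u = ∃[ N ] ∃[ p ] (1 ≤ p × (∀ n → N ≤ n → u (n + p) ≡ u n))

module Submission where

-- Let α(m) ∈ {0,…,L−1} be the index of the m-th letter of A_∞ and Q_n = q_1⋯q_n = |A_n|.
-- Block d of A_{n+1} is f^{μ_n(d)}(A_n), so reading m in the mixed radix (q_1, q_2, …)
-- shows that α is additive across levels:
--     α(k·Q_n + r) ≡ α(k·Q_n) + α(r)  (mod L)  for r < Q_n,    α(d·Q_n) ≡ μ_n(d)  for d < q_{n+1}.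
-- The theorem is a consequence of three facts about an arbitrary α that is additive at some Q:
--   * if α(k·Q) ≡ c·k for all k, then α is periodic with period L·Q            (giving ⇐);
--   * if α is periodic from N with period p and N + p ≤ Q, then α(k·Q) ≡ k·α(Q);
--     with Q = Q_A, A = N + p, and k = s·q_{A+1}⋯q_{A+y} this is the condition (giving ⇒);
--   * if Q > l and n ↦ α(N + n·l) is ultimately periodic, so is α: every multiple k·Q can be
--     padded by some r ≤ l into the progression N + lℕ, and cancelling α(r) shows that the
--     multiples of Q, hence all of α, are eventually periodic                    (subsequences).

open import Defs
open import Data.Nat using (ℕ; zero; suc; _+_; _*_; _∸_; _≤_; _<_; NonZero; z≤n; s≤s; pred; >-nonZero; >-nonZero⁻¹)
open import Data.Nat.Properties
open import Data.Nat.DivMod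
open import Data.Nat.Induction using (<-wellFounded)
open import Data.Nat.Tactic.RingSolver using (solve-∀)
open import Data.Fin using (Fin; toℕ)
open import Data.Fin.Properties using (toℕ-injective; toℕ-fromℕ<; toℕ<n)
open import Data.List using (List; []; _∷_; map; concat; applyUpTo; upTo; length; _++_)
open import Data.List.Properties using (length-++; length-map; map-upTo)
open import Data.Product using (_×_; ∃-syntax; _,_)
open import Data.Sum using (inj₁; inj₂)
open import Function using (_∘_; _⇔_)
open import Function.Bundles using (mk⇔)
open import Function.Definitions using (Injective)
open import Induction.WellFounded using (Acc; acc)
open import Relation.Binary.PropositionalEquality
import Relation.Binary.Construct.On as On
import Relation.Binary.Reasoning.Setoid as SetoidReasoning
open import Relation.Nullary using (¬_)

module _ {A : Set} (d : A) where

  nth-++ˡ : (xs ys : List A) (i : ℕ) → i < length xs → nth d (xs ++ ys) i ≡ nth d xs i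
  nth-++ˡ (x ∷ xs) ys zero    _         = refl
  nth-++ˡ (x ∷ xs) ys (suc i) (s≤s i<n) = nth-++ˡ xs ys i i<n

  nth-++ʳ : (xs ys : List A) (i : ℕ) → nth d (xs ++ ys) (length xs + i) ≡ nth d ys i
  nth-++ʳ []       ys i = refl
  nth-++ʳ (x ∷ xs) ys i = nth-++ʳ xs ys i

  nth-map : {B : Set} (e : B) (f : B → A) (xs : List B) (i : ℕ) → i < length xs →
            nth d (map f xs) i ≡ f (nth e xs i)
  nth-map e f (x ∷ xs) zero    _         = refl
  nth-map e f (x ∷ xs) (suc i) (s≤s i<n) = nth-map e f xs i i<n

  length-concat-blocks : (c : ℕ) (G : ℕ → List A) → (∀ k → length (G k) ≡ c) →
                         ∀ m → length (concat (applyUpTo G m)) ≡ m * c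
  length-concat-blocks c G len zero    = refl
  length-concat-blocks c G len (suc m) =
    trans (length-++ (G 0)) (cong₂ _+_ (len 0) (length-concat-blocks c (G ∘ suc) (len ∘ suc) m))

  nth-concat-blocks : (c : ℕ) (G : ℕ → List A) → (∀ k → length (G k) ≡ c) →
                      ∀ m j r → j < m → r < c →
                      nth d (concat (applyUpTo G m)) (j * c + r) ≡ nth d (G j) r
  nth-concat-blocks c G len (suc m) zero    r _         r<c =
    nth-++ˡ (G 0) _ r (subst (r <_) (sym (len 0)) r<c)
  nth-concat-blocks c G len (suc m) (suc j) r (s≤s j<m) r<c = begin
      nth d (G 0 ++ rest) (c + j * c + r)          ≡⟨ cong (nth d (G 0 ++ rest)) index ⟩
      nth d (G 0 ++ rest) (length (G 0) + (j * c + r)) ≡⟨ nth-++ʳ (G 0) rest _ ⟩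
      nth d rest (j * c + r)                       ≡⟨ nth-concat-blocks c (G ∘ suc) (len ∘ suc) m j r j<m r<c ⟩
      nth d (G (suc j)) r                          ∎
    where
    open ≡-Reasoning
    rest : List A
    rest = concat (applyUpTo (G ∘ suc) m)
    index : c + j * c + r ≡ length (G 0) + (j * c + r)
    index = trans (+-assoc c (j * c) r) (cong (_+ (j * c + r)) (sym (len 0)))

periodic-relabel : {A B C : Set} {g : A → B} (h : A → C) (u : ℕ → A) →
                   Injective _≡_ _≡_ g → UltPeriodic (g ∘ u) → UltPeriodic (h ∘ u)
periodic-relabel h u g-injective (N , p , 1≤p , periodic) =
  N , p , 1≤p , λ n N≤n → cong h (g-injective (periodic n N≤n))

period-iterate : {A : Set} (f : ℕ → A) {N p : ℕ} → (∀ n → N ≤ n → f (n + p) ≡ f n) →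
                 ∀ t n → N ≤ n → f (n + t * p) ≡ f n
period-iterate f periodic zero    n N≤n = cong f (+-identityʳ n)
period-iterate f {N} {p} periodic (suc t) n N≤n = begin
    f (n + (p + t * p)) ≡⟨ cong f (trans (cong (n +_) (+-comm p (t * p))) (sym (+-assoc n (t * p) p))) ⟩
    f (n + t * p + p)   ≡⟨ periodic (n + t * p) (≤-trans N≤n (m≤m+n n (t * p))) ⟩
    f (n + t * p)       ≡⟨ period-iterate f periodic t n N≤n ⟩
    f n                 ∎
  where open ≡-Reasoning

reduce-into-window : ∀ N p .{{_ : NonZero p}} m → N ≤ m →
                     m ≡ N + (m ∸ N) % p + (m ∸ N) / p * p
reduce-into-window N p m N≤m =
  trans (sym (m+[n∸m]≡n N≤m))
        (trans (cong (N +_) (m≡m%n+[m/n]*n (m ∸ N) p)) (sym (+-assoc N _ _)))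

pad-into-progression : ∀ N N' l .{{_ : NonZero l}} x → N + N' * l ≤ x →
                       ∃[ r ] ∃[ n ] (r ≤ l × N' ≤ n × x + r ≡ N + n * l)
pad-into-progression N N' l x bound = l ∸ e , suc n₀ , m∸n≤m l e , N'≤n , padded
  where
  open ≡-Reasoning
  y : ℕ
  y = x ∸ N
  e : ℕ
  e = y % l
  n₀ : ℕ
  n₀ = y / l
  regroup : ∀ N e a r → N + (e + a) + r ≡ N + ((e + r) + a)
  regroup = solve-∀
  padded : x + (l ∸ e) ≡ N + (l + n₀ * l)
  padded = begin
    x + (l ∸ e)                   ≡⟨ cong (_+ (l ∸ e)) (reduce-into-window N l x (≤-trans (m≤m+n N _) bound)) ⟩
    N + e + n₀ * l + (l ∸ e)      ≡⟨ cong (_+ (l ∸ e)) (+-assoc N e (n₀ * l)) ⟩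
    N + (e + n₀ * l) + (l ∸ e)    ≡⟨ regroup N e (n₀ * l) (l ∸ e) ⟩
    N + ((e + (l ∸ e)) + n₀ * l)  ≡⟨ cong (λ z → N + (z + n₀ * l)) (m+[n∸m]≡n (<⇒≤ (m%n<n y l))) ⟩
    N + (l + n₀ * l)              ∎
  N'l≤y : N' * l ≤ y
  N'l≤y = subst (_≤ y) (m+n∸m≡n N (N' * l)) (∸-monoˡ-≤ N bound)
  N'≤n : N' ≤ suc n₀
  N'≤n = ≤-trans (subst (_≤ n₀) (m*n/n≡m N' l) (/-monoˡ-≤ l N'l≤y)) (n≤1+n n₀)

module Congruence (L : ℕ) .{{_ : NonZero L}} where

  infix 4 _≈_
  _≈_ : ℕ → ℕ → Set
  x ≈ y = x % L ≡ y % L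

  module ≈-Reasoning = SetoidReasoning (On.setoid (setoid ℕ) (_% L))

  PeriodicMod : (ℕ → ℕ) → Set
  PeriodicMod α = UltPeriodic (λ n → α n % L)

  +-cong : ∀ {a b c d} → a ≈ b → c ≈ d → a + c ≈ b + d
  +-cong {a} {b} {c} {d} a≈b c≈d =
    trans (%-distribˡ-+ a c L) (trans (cong₂ (λ x y → (x + y) % L) a≈b c≈d) (sym (%-distribˡ-+ b d L)))

  *-cong : ∀ {a b c d} → a ≈ b → c ≈ d → a * c ≈ b * d
  *-cong {a} {b} {c} {d} a≈b c≈d =
    trans (%-distribˡ-* a c L) (trans (cong₂ (λ x y → (x * y) % L) a≈b c≈d) (sym (%-distribˡ-* b d L)))

  -- cancellation: add the complement L − (c mod L), which is ≡ −c
  +-cancelʳ : ∀ a b c → a + c ≈ b + c → a ≈ b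
  +-cancelʳ a b c a+c≈b+c = begin
      a             ≡⟨ sym (+-identityʳ a) ⟩
      a + 0         ≈⟨ +-cong {a} refl (sym c+c̄≈0) ⟩
      a + (c + c̄)   ≡⟨ sym (+-assoc a c c̄) ⟩
      a + c + c̄     ≈⟨ +-cong a+c≈b+c refl ⟩
      b + c + c̄     ≡⟨ +-assoc b c c̄ ⟩
      b + (c + c̄)   ≈⟨ +-cong {b} refl c+c̄≈0 ⟩
      b + 0         ≡⟨ +-identityʳ b ⟩
      b             ∎
    where
    open ≈-Reasoning
    c̄ : ℕ
    c̄ = L ∸ c % L
    c+c̄≈0 : c + c̄ ≈ 0
    c+c̄≈0 = begin
      c + c̄           ≈⟨ +-cong {c} (sym (m%n%n≡m%n c L)) refl ⟩
      c % L + c̄       ≡⟨ m+[n∸m]≡n (<⇒≤ (m%n<n c L)) ⟩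
      L               ≈⟨ trans (n%n≡0 L) (sym (m*n%n≡0 0 L)) ⟩
      0               ∎

  toℕ-mod-injective : Injective _≡_ _≡_ (λ (i : Fin L) → toℕ i % L)
  toℕ-mod-injective {i} {j} i≈j =
    toℕ-injective (trans (sym (m<n⇒m%n≡m (toℕ<n i))) (trans i≈j (m<n⇒m%n≡m (toℕ<n j))))

  SplitsAt : (ℕ → ℕ) → ℕ → ℕ → Set
  SplitsAt α Q k = ∀ r → r < Q → α (k * Q + r) ≈ α (k * Q) + α r

  module Additive (α : ℕ → ℕ) (Q : ℕ) .{{_ : NonZero Q}} (additive : ∀ k → SplitsAt α Q k) where
    open ≈-Reasoning

    additive-split : ∀ m → α m ≈ α (m / Q * Q) + α (m % Q)
    additive-split m =
      trans (cong (λ x → α x % L) (trans (m≡m%n+[m/n]*n m Q) (+-comm (m % Q) _)))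
            (additive (m / Q) (m % Q) (m%n<n m Q))

    additive-shift : ∀ m j → α (m + j * Q) ≈ α ((m / Q + j) * Q) + α (m % Q)
    additive-shift m j =
      trans (cong (λ x → α x % L) (trans (cong (_+ j * Q) (m≡m%n+[m/n]*n m Q)) (regroup (m % Q) (m / Q) j Q)))
            (additive (m / Q + j) (m % Q) (m%n<n m Q))
      where
      regroup : ∀ r k j Q → r + k * Q + j * Q ≡ (k + j) * Q + r
      regroup = solve-∀

    linear⇒periodic : ∀ c → (∀ k → α (k * Q) ≈ c * k) → PeriodicMod α
    linear⇒periodic c linear =
      0 , L * Q , *-mono-≤ (>-nonZero⁻¹ L) (>-nonZero⁻¹ Q) , λ m _ → period m
      where
      regroup : ∀ c k L r → c * (k + L) + r ≡ c * k + r + c * L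
      regroup = solve-∀
      period : ∀ m → α (m + L * Q) ≈ α m
      period m = begin
        α (m + L * Q)                       ≈⟨ additive-shift m L ⟩
        α ((m / Q + L) * Q) + α (m % Q)     ≈⟨ +-cong (linear (m / Q + L)) refl ⟩
        c * (m / Q + L) + α (m % Q)         ≡⟨ regroup c (m / Q) L (α (m % Q)) ⟩
        c * (m / Q) + α (m % Q) + c * L     ≈⟨ [m+kn]%n≡m%n (c * (m / Q) + α (m % Q)) c L ⟩
        c * (m / Q) + α (m % Q)             ≈⟨ +-cong (sym (linear (m / Q))) refl ⟩
        α (m / Q * Q) + α (m % Q)           ≈⟨ sym (additive-split m) ⟩
        α m                                 ∎

    periodic⇒linear : α 0 ≈ 0 → ∀ {N p} → 1 ≤ p → (∀ n → N ≤ n → α (n + p) ≈ α n) →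
                      N + p ≤ Q → ∀ k → α (k * Q) ≈ k * α Q
    periodic⇒linear α0≈0 {N} {p} 1≤p periodic N+p≤Q = linear
      where
      instance
        p-nonZero : NonZero p
        p-nonZero = >-nonZero 1≤p
      -- Q = j + t·p with j in the window [N, N + p)
      j : ℕ
      j = N + (Q ∸ N) % p
      t : ℕ
      t = (Q ∸ N) / p
      j<Q : j < Q
      j<Q = <-≤-trans (+-monoʳ-< N (m%n<n (Q ∸ N) p)) N+p≤Q
      skip-periods : ∀ x → α (x + Q) ≈ α (x + j)
      skip-periods x = begin
        α (x + Q)           ≡⟨ cong (λ z → α (x + z)) (reduce-into-window N p Q (≤-trans (m≤m+n N p) N+p≤Q)) ⟩
        α (x + (j + t * p)) ≡⟨ cong α (sym (+-assoc x j (t * p))) ⟩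
        α (x + j + t * p)   ≈⟨ period-iterate (λ n → α n % L) periodic t (x + j) (≤-trans (m≤m+n N _) (m≤n+m j x)) ⟩
        α (x + j)           ∎
      linear : ∀ k → α (k * Q) ≈ k * α Q
      linear zero    = α0≈0
      linear (suc k) = begin
        α (Q + k * Q)       ≡⟨ cong α (+-comm Q (k * Q)) ⟩
        α (k * Q + Q)       ≈⟨ skip-periods (k * Q) ⟩
        α (k * Q + j)       ≈⟨ additive k j j<Q ⟩
        α (k * Q) + α j     ≈⟨ +-cong (linear k) (sym (skip-periods 0)) ⟩
        k * α Q + α Q       ≡⟨ +-comm (k * α Q) (α Q) ⟩
        α Q + k * α Q       ∎

    subsequence⇒periodic : ∀ N l → 1 ≤ l → l < Q → PeriodicMod (λ n → α (N + n * l)) → PeriodicMod α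
    subsequence⇒periodic N l 1≤l l<Q (N' , p , 1≤p , periodic) =
      K * Q , p * l * Q , *-mono-≤ (*-mono-≤ 1≤p 1≤l) (>-nonZero⁻¹ Q) , period
      where
      instance
        l-nonZero : NonZero l
        l-nonZero = >-nonZero 1≤l
      K : ℕ
      K = N + N' * l
      regroupˡ : ∀ k P Q r → (k + P) * Q + r ≡ k * Q + r + P * Q
      regroupˡ = solve-∀
      regroupʳ : ∀ N n l Q p → N + n * l + p * l * Q ≡ N + (n + Q * p) * l
      regroupʳ = solve-∀
      multiples-periodic : ∀ k → K ≤ k → α ((k + p * l) * Q) ≈ α (k * Q)
      multiples-periodic k K≤k with pad-into-progression N N' l (k * Q) (≤-trans K≤k (m≤m*n k Q))
      ... | r , n , r≤l , N'≤n , padded = +-cancelʳ _ _ (α r) (begin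
        α ((k + p * l) * Q) + α r        ≈⟨ sym (additive (k + p * l) r r<Q) ⟩
        α ((k + p * l) * Q + r)          ≡⟨ cong α (regroupˡ k (p * l) Q r) ⟩
        α (k * Q + r + p * l * Q)        ≡⟨ cong (λ z → α (z + p * l * Q)) padded ⟩
        α (N + n * l + p * l * Q)        ≡⟨ cong α (regroupʳ N n l Q p) ⟩
        α (N + (n + Q * p) * l)          ≈⟨ period-iterate (λ n → α (N + n * l) % L) periodic Q n N'≤n ⟩
        α (N + n * l)                    ≡⟨ cong α (sym padded) ⟩
        α (k * Q + r)                    ≈⟨ additive k r r<Q ⟩
        α (k * Q) + α r                  ∎)
        where
        r<Q : r < Q
        r<Q = ≤-<-trans r≤l l<Q
      period : ∀ m → K * Q ≤ m → α (m + p * l * Q) ≈ α m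
      period m KQ≤m = begin
        α (m + p * l * Q)                   ≈⟨ additive-shift m (p * l) ⟩
        α ((m / Q + p * l) * Q) + α (m % Q) ≈⟨ +-cong (multiples-periodic (m / Q) K≤m/Q) refl ⟩
        α (m / Q * Q) + α (m % Q)           ≈⟨ sym (additive-split m) ⟩
        α m                                 ∎
        where
        K≤m/Q : K ≤ m / Q
        K≤m/Q = subst (_≤ m / Q) (m*n/n≡m K Q) (/-monoˡ-≤ Q KQ≤m)

module ThueMorse (L : ℕ) .{{_ : NonZero L}} (q : ℕ → ℕ) (q≥2 : ∀ n → 2 ≤ q (suc n))
                 (μ : ℕ → ℕ → Fin L) where
  open Congruence L

  instance
    q-nonZero : ∀ {n} → NonZero (q (suc n))
    q-nonZero {n} = >-nonZero (≤-trans (s≤s z≤n) (q≥2 n))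

  Q : ℕ → ℕ
  Q zero    = 1
  Q (suc n) = q (suc n) * Q n

  Q-nonZero : ∀ n → NonZero (Q n)
  Q-nonZero zero    = _
  Q-nonZero (suc n) = m*n≢0 (q (suc n)) (Q n) {{q-nonZero}} {{Q-nonZero n}}

  Q-positive : ∀ n → 1 ≤ Q n
  Q-positive n = >-nonZero⁻¹ (Q n) {{Q-nonZero n}}

  Q-mono : ∀ n → Q n ≤ Q (suc n)
  Q-mono n = m≤n*m (Q n) (q (suc n))

  n<Q : ∀ n → n < Q n
  n<Q zero    = s≤s z≤n
  n<Q (suc n) = begin-strict
      suc n            <⟨ s≤s (n<Q n) ⟩
      suc (Q n)        ≤⟨ +-monoˡ-≤ (Q n) (Q-positive n) ⟩
      Q n + Q n        ≡⟨ cong (Q n +_) (sym (+-identityʳ (Q n))) ⟩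
      2 * Q n          ≤⟨ *-monoˡ-≤ (Q n) (q≥2 n) ⟩
      q (suc n) * Q n  ∎
    where open ≤-Reasoning

  Q-split : ∀ A y → Q (A + y) ≡ prodRange q A y * Q A
  Q-split A zero    = trans (cong Q (+-identityʳ A)) (sym (*-identityˡ (Q A)))
  Q-split A (suc y) = begin
      Q (A + suc y)                             ≡⟨ cong Q (+-suc A y) ⟩
      q (suc (A + y)) * Q (A + y)               ≡⟨ cong₂ (λ m P → q m * P) (sym (+-suc A y)) (Q-split A y) ⟩
      q (A + suc y) * (prodRange q A y * Q A)   ≡⟨ regroup (q (A + suc y)) (prodRange q A y) (Q A) ⟩
      prodRange q A y * q (A + suc y) * Q A     ∎
    where
    open ≡-Reasoning
    regroup : ∀ a b c → a * (b * c) ≡ b * a * c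
    regroup = solve-∀

  digit-bound : ∀ n d r → d < q (suc n) → r < Q n → d * Q n + r < Q (suc n)
  digit-bound n d r d<q r<Q = begin-strict
      d * Q n + r      <⟨ +-monoʳ-< (d * Q n) r<Q ⟩
      d * Q n + Q n    ≡⟨ +-comm (d * Q n) (Q n) ⟩
      suc d * Q n      ≤⟨ *-monoˡ-≤ (Q n) d<q ⟩
      q (suc n) * Q n  ∎
    where open ≤-Reasoning

  digit-split : ∀ n k r → k * Q n + r ≡ k / q (suc n) * Q (suc n) + (k % q (suc n) * Q n + r)
  digit-split n k r =
    trans (cong (λ z → z * Q n + r) (m≡m%n+[m/n]*n k (q (suc n))))
          (regroup (k % q (suc n)) (k / q (suc n)) (q (suc n)) (Q n) r)
    where
    regroup : ∀ d k q Q r → (d + k * q) * Q + r ≡ k * (q * Q) + (d * Q + r)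
    regroup = solve-∀

  -- the letter a_0, also the out-of-range default of nth in TMindex
  default : Fin L
  default = 0 mod L

  W : ℕ → List (Fin L)
  W = TMword L q μ

  block : ℕ → ℕ → List (Fin L)
  block n k = fpow L (blockExp μ n k) (W n)

  length-W : ∀ n → length (W n) ≡ Q n
  length-W zero    = refl
  length-W (suc n) =
    trans (cong (length ∘ concat) (map-upTo (block n) (q (suc n))))
          (length-concat-blocks default (Q n) (block n)
                                (λ k → trans (length-map _ (W n)) (length-W n)) (q (suc n)))

  length-block : ∀ n k → length (block n k) ≡ Q n
  length-block n k = trans (length-map _ (W n)) (length-W n)

  W-block : ∀ n d r → d < q (suc n) → r < Q n →
            nth default (W (suc n)) (d * Q n + r) ≡ shift L (blockExp μ n d) (nth default (W n) r)
  W-block n d r d<q r<Q = begin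
      nth default (concat (map (block n) (upTo (q (suc n))))) (d * Q n + r)
        ≡⟨ cong (λ ws → nth default (concat ws) (d * Q n + r)) (map-upTo (block n) (q (suc n))) ⟩
      nth default (concat (applyUpTo (block n) (q (suc n)))) (d * Q n + r)
        ≡⟨ nth-concat-blocks default (Q n) (block n) (length-block n) (q (suc n)) d r d<q r<Q ⟩
      nth default (block n d) r
        ≡⟨ nth-map default default (shift L (blockExp μ n d)) (W n) r (subst (r <_) (sym (length-W n)) r<Q) ⟩
      shift L (blockExp μ n d) (nth default (W n) r) ∎
    where open ≡-Reasoning

  shift-zero : ∀ i → shift L 0 i ≡ i
  shift-zero i = toℕ-injective
    (trans (toℕ-fromℕ< _) (trans (cong (_% L) (+-identityʳ (toℕ i))) (m<n⇒m%n≡m (toℕ<n i))))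

  W-prefix : ∀ n t m → m < Q n → nth default (W (t + n)) m ≡ nth default (W n) m
  W-prefix n zero    m m<Q = refl
  W-prefix n (suc t) m m<Q =
    trans (trans (W-block (t + n) 0 m (≤-trans (s≤s z≤n) (q≥2 (t + n))) (long t)) (shift-zero _))
          (W-prefix n t m m<Q)
    where
    long : ∀ t → m < Q (t + n)
    long zero    = m<Q
    long (suc t) = <-≤-trans (long t) (Q-mono (t + n))

  TMindex-nth : ∀ n m → m < Q n → TMindex L q μ m ≡ nth default (W n) m
  TMindex-nth n m m<Q with ≤-total m n
  ... | inj₁ m≤n = sym (trans (cong (λ z → nth default (W z) m) (sym (m∸n+n≡m m≤n)))
                              (W-prefix m (n ∸ m) m (n<Q m)))
  ... | inj₂ n≤m = trans (cong (λ z → nth default (W z) m) (sym (m∸n+n≡m n≤m)))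
                         (W-prefix n (m ∸ n) m m<Q)

  α : ℕ → ℕ
  α m = toℕ (TMindex L q μ m)

  α0 : α 0 ≡ 0
  α0 = trans (toℕ-fromℕ< _) (m*n%n≡0 0 L)

  α-block : ∀ n d r → d < q (suc n) → r < Q n → α (d * Q n + r) ≈ blockExp μ n d + α r
  α-block n d r d<q r<Q = begin
      α (d * Q n + r)                                          ≡⟨ cong toℕ (TMindex-nth (suc n) _ (digit-bound n d r d<q r<Q)) ⟩
      toℕ (nth default (W (suc n)) (d * Q n + r))             ≡⟨ cong toℕ (W-block n d r d<q r<Q) ⟩
      toℕ (shift L (blockExp μ n d) (nth default (W n) r))     ≡⟨ toℕ-fromℕ< _ ⟩
      (toℕ (nth default (W n) r) + blockExp μ n d) % L         ≈⟨ m%n%n≡m%n _ L ⟩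
      toℕ (nth default (W n) r) + blockExp μ n d               ≡⟨ cong (λ i → toℕ i + blockExp μ n d) (sym (TMindex-nth n r r<Q)) ⟩
      α r + blockExp μ n d                                     ≡⟨ +-comm (α r) _ ⟩
      blockExp μ n d + α r                                     ∎
    where open ≈-Reasoning

  α-digit : ∀ n d → d < q (suc n) → α (d * Q n) ≈ blockExp μ n d
  α-digit n d d<q = begin
      α (d * Q n)               ≡⟨ cong α (sym (+-identityʳ (d * Q n))) ⟩
      α (d * Q n + 0)           ≈⟨ α-block n d 0 d<q (Q-positive n) ⟩
      blockExp μ n d + α 0      ≡⟨ cong (blockExp μ n d +_) α0 ⟩
      blockExp μ n d + 0        ≡⟨ +-identityʳ (blockExp μ n d) ⟩
      blockExp μ n d            ∎
    where open ≈-Reasoning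

  lift-digit : ∀ n k r → r < Q n → SplitsAt α (Q (suc n)) (k / q (suc n)) →
               α (k * Q n + r) ≈ α (k / q (suc n) * Q (suc n)) + α (k % q (suc n) * Q n + r)
  lift-digit n k r r<Q splits =
    trans (cong (λ x → α x % L) (digit-split n k r))
          (splits _ (digit-bound n _ r (m%n<n k (q (suc n))) r<Q))

  carry-with : ∀ n k → SplitsAt α (Q (suc n)) (k / q (suc n)) →
               α (k * Q n) ≈ α (k / q (suc n) * Q (suc n)) + blockExp μ n (k % q (suc n))
  carry-with n k splits = begin
      α (k * Q n)                 ≡⟨ cong α (sym (+-identityʳ (k * Q n))) ⟩
      α (k * Q n + 0)             ≈⟨ lift-digit n k 0 (Q-positive n) splits ⟩
      α (k' * Q (suc n)) + α (d * Q n + 0) ≡⟨ cong (λ x → α (k' * Q (suc n)) + α x) (+-identityʳ (d * Q n)) ⟩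
      α (k' * Q (suc n)) + α (d * Q n)     ≈⟨ +-cong refl (α-digit n d (m%n<n k (q (suc n)))) ⟩
      α (k' * Q (suc n)) + blockExp μ n d  ∎
    where
    open ≈-Reasoning
    k' : ℕ
    k' = k / q (suc n)
    d : ℕ
    d = k % q (suc n)

  -- α is additive at every level; induction on k, whose quotient k / q_{n+1} is smaller
  α-additive : ∀ n k → SplitsAt α (Q n) k
  α-additive n k = additive-acc k (<-wellFounded k) n
    where
    additive-acc : ∀ k → Acc _<_ k → ∀ n → SplitsAt α (Q n) k
    additive-acc zero      _             n r _   = cong (λ x → (x + α r) % L) (sym α0)
    additive-acc k@(suc _) (acc smaller) n r r<Q = begin
        α (k * Q n + r)                          ≈⟨ lift-digit n k r r<Q splits ⟩
        α (k' * Q (suc n)) + α (d * Q n + r)     ≈⟨ +-cong refl (α-block n d r (m%n<n k (q (suc n))) r<Q) ⟩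
        α (k' * Q (suc n)) + (blockExp μ n d + α r) ≡⟨ sym (+-assoc (α (k' * Q (suc n))) _ (α r)) ⟩
        α (k' * Q (suc n)) + blockExp μ n d + α r ≈⟨ +-cong (sym (carry-with n k splits)) refl ⟩
        α (k * Q n) + α r                        ∎
      where
      open ≈-Reasoning
      k' : ℕ
      k' = k / q (suc n)
      d : ℕ
      d = k % q (suc n)
      splits : SplitsAt α (Q (suc n)) k'
      splits = additive-acc k' (smaller (m/n<m k (q (suc n)) (q≥2 n))) (suc n)

  Condition : ℕ → Set
  Condition A = ∀ y s → 1 ≤ s → s ≤ q (A + y + 1) ∸ 1 →
    toℕ (μ (A + y) s) % L ≡ (toℕ (μ A 1) * s * q 0 * prodRange q A y) % L

  module _ (q0≡1 : q 0 ≡ 1) where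

    condition⇒digits : ∀ A → Condition A → ∀ y d → d < q (suc (A + y)) →
                       blockExp μ (A + y) d ≈ toℕ (μ A 1) * d * prodRange q A y
    condition⇒digits A condition y zero    _   =
      sym (cong (λ x → (x * prodRange q A y) % L) (*-zeroʳ (toℕ (μ A 1))))
    condition⇒digits A condition y (suc d) d<q = begin
        toℕ (μ (A + y) (suc d))           ≈⟨ condition y (suc d) (s≤s z≤n) d≤q-1 ⟩
        c * suc d * q 0 * P               ≡⟨ cong (λ x → c * suc d * x * P) q0≡1 ⟩
        c * suc d * 1 * P                 ≡⟨ cong (_* P) (*-identityʳ (c * suc d)) ⟩
        c * suc d * P                     ∎
      where
      open ≈-Reasoning
      c : ℕ
      c = toℕ (μ A 1)
      P : ℕ
      P = prodRange q A y
      d≤q-1 : suc d ≤ q (A + y + 1) ∸ 1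
      d≤q-1 = subst (λ m → suc d ≤ pred (q m)) (+-comm 1 (A + y)) (<⇒≤pred d<q)

    condition⇒linear : ∀ A → Condition A → ∀ y k →
                       α (k * Q (A + y)) ≈ toℕ (μ A 1) * k * prodRange q A y
    condition⇒linear A condition y k = linear-acc k (<-wellFounded k) y
      where
      c : ℕ
      c = toℕ (μ A 1)
      regroup : ∀ c k P q d → c * k * (P * q) + c * d * P ≡ c * (d + k * q) * P
      regroup = solve-∀
      linear-acc : ∀ k → Acc _<_ k → ∀ y → α (k * Q (A + y)) ≈ c * k * prodRange q A y
      linear-acc zero      _             y = trans (cong (_% L) α0)
                                                   (sym (cong (λ x → (x * prodRange q A y) % L) (*-zeroʳ c)))
      linear-acc k@(suc _) (acc smaller) y = begin
          α (k * Q n)                                        ≈⟨ carry-with n k (α-additive (suc n) k') ⟩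
          α (k' * Q (suc n)) + blockExp μ n d                ≡⟨ cong (λ m → α (k' * Q m) + blockExp μ n d) (sym (+-suc A y)) ⟩
          α (k' * Q (A + suc y)) + blockExp μ n d            ≈⟨ +-cong (linear-acc k' (smaller k'<k) (suc y)) (condition⇒digits A condition y d d<q) ⟩
          c * k' * (P * q (A + suc y)) + c * d * P           ≡⟨ cong (λ m → c * k' * (P * q m) + c * d * P) (+-suc A y) ⟩
          c * k' * (P * q (suc n)) + c * d * P               ≡⟨ regroup c k' P (q (suc n)) d ⟩
          c * (d + k' * q (suc n)) * P                       ≡⟨ cong (λ x → c * x * P) (sym (m≡m%n+[m/n]*n k (q (suc n)))) ⟩
          c * k * P                                          ∎
        where
        open ≈-Reasoning
        n : ℕ
        n = A + y
        P : ℕ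
        P  = prodRange q A y
        k' : ℕ
        k' = k / q (suc n)
        d : ℕ
        d = k % q (suc n)
        d<q : d < q (suc n)
        d<q = m%n<n k (q (suc n))
        k'<k : k' < k
        k'<k = m/n<m k (q (suc n)) (q≥2 n)

    condition⇒periodic : ∀ A → Condition A → PeriodicMod α
    condition⇒periodic A condition =
      Additive.linear⇒periodic α (Q A) {{Q-nonZero A}} (α-additive A) (toℕ (μ A 1)) linear
      where
      linear : ∀ k → α (k * Q A) ≈ toℕ (μ A 1) * k
      linear k = begin
        α (k * Q A)                 ≡⟨ cong (λ m → α (k * Q m)) (sym (+-identityʳ A)) ⟩
        α (k * Q (A + 0))           ≈⟨ condition⇒linear A condition 0 k ⟩
        toℕ (μ A 1) * k * 1         ≡⟨ *-identityʳ _ ⟩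
        toℕ (μ A 1) * k             ∎
        where open ≈-Reasoning

    periodic⇒condition : PeriodicMod α → ∃[ A ] Condition A
    periodic⇒condition (N , p , 1≤p , periodic) = A , condition
      where
      A : ℕ
      A = N + p
      linear : ∀ k → α (k * Q A) ≈ k * α (Q A)
      linear = Additive.periodic⇒linear α (Q A) {{Q-nonZero A}} (α-additive A) (cong (_% L) α0) 1≤p periodic (<⇒≤ (n<Q A))
      αQ≈c : α (Q A) ≈ toℕ (μ A 1)
      αQ≈c = trans (cong (λ m → α m % L) (sym (*-identityˡ (Q A)))) (α-digit A 1 (q≥2 A))
      regroup : ∀ s P c → s * P * c ≡ c * s * 1 * P
      regroup = solve-∀
      condition : Condition A
      condition y zero    ()
      condition y (suc s) _ s≤q-1 = begin
          toℕ (μ n (suc s))          ≈⟨ sym (α-digit n (suc s) s<q) ⟩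
          α (suc s * Q n)            ≡⟨ cong (λ m → α (suc s * m)) (Q-split A y) ⟩
          α (suc s * (P * Q A))      ≡⟨ cong α (sym (*-assoc (suc s) P (Q A))) ⟩
          α (suc s * P * Q A)        ≈⟨ linear (suc s * P) ⟩
          suc s * P * α (Q A)        ≈⟨ *-cong {suc s * P} refl αQ≈c ⟩
          suc s * P * c              ≡⟨ regroup (suc s) P c ⟩
          c * suc s * 1 * P          ≡⟨ cong (λ x → c * suc s * x * P) (sym q0≡1) ⟩
          c * suc s * q 0 * P        ∎
        where
        open ≈-Reasoning
        n : ℕ
        n = A + y
        P : ℕ
        P = prodRange q A y
        c : ℕ
        c = toℕ (μ A 1)
        s<q : suc s < q (suc n)
        s<q = m≤pred[n]⇒suc[m]≤n (subst (λ m → suc s ≤ pred (q m)) (+-comm n 1) s≤q-1)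

  subsequence⇒periodic : ∀ N l → 1 ≤ l → PeriodicMod (λ n → α (N + n * l)) → PeriodicMod α
  subsequence⇒periodic N l 1≤l =
    Additive.subsequence⇒periodic α (Q l) {{Q-nonZero l}} (α-additive l) N l 1≤l (n<Q l)

lemma5p4 : (L : ℕ) .{{_ : NonZero L}} → 2 ≤ L →
    (q : ℕ → ℕ) → q 0 ≡ 1 → (∀ n → 2 ≤ q (n + 1)) →
    (μ : ℕ → ℕ → Fin L) →
    {X : Set} (ℓ : Fin L → X) → Injective _≡_ _≡_ ℓ →
    (UltPeriodic (TMseq L ℓ q μ) ⇔
      (∃[ A ] (∀ y s → 1 ≤ s → s ≤ q (A + y + 1) ∸ 1 →
        toℕ (μ (A + y) s) % L ≡ (toℕ (μ A 1) * s * q 0 * prodRange q A y) % L)))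
    × (¬ UltPeriodic (TMseq L ℓ q μ) →
        ∀ N l → 1 ≤ l → ¬ UltPeriodic (λ n → TMseq L ℓ q μ (N + n * l)))
lemma5p4 L _ q q0≡1 q≥2 μ ℓ ℓ-injective = mk⇔ only-if if , subsequences
  where
  open Congruence L
  open ThueMorse L q (λ n → subst (λ m → 2 ≤ q m) (+-comm n 1) (q≥2 n)) μ
  index : ℕ → Fin L
  index = TMindex L q μ
  mod-L : Fin L → ℕ
  mod-L i = toℕ i % L

  only-if : UltPeriodic (TMseq L ℓ q μ) → ∃[ A ] Condition A
  only-if periodic = periodic⇒condition q0≡1 (periodic-relabel mod-L index ℓ-injective periodic)

  if : ∃[ A ] Condition A → UltPeriodic (TMseq L ℓ q μ)
  if (A , condition) =
    periodic-relabel ℓ index toℕ-mod-injective (condition⇒periodic q0≡1 A condition)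

  subsequences : ¬ UltPeriodic (TMseq L ℓ q μ) →
                 ∀ N l → 1 ≤ l → ¬ UltPeriodic (λ n → TMseq L ℓ q μ (N + n * l))
  subsequences not-periodic N l 1≤l periodic = not-periodic
    (periodic-relabel ℓ index toℕ-mod-injective
      (subsequence⇒periodic N l 1≤l
        (periodic-relabel mod-L (λ n → index (N + n * l)) ℓ-injective periodic)))
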